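{- Fix integers $n,d\ge 0$, a prime $p$, an integer $k_0\ge 0$, and an element $\gamma\in\tilde{H}_{d-1}(\mathsf{M}_n;\mathbb{Z})$. For $k\ge 0$ let $z_{k,k+1}$ be the cycle \[ z_{k,k+1}=\sum_{\pi\in\mathfrak{S}_{[k+1]}}\mathrm{sgn}(\pi)\, 1\overline{\pi(1)}\wedge\cdots\wedge k\overline{\pi(k)} \] in $\tilde{C}_{k-1}(\mathsf{M}_{k,k+1};\mathbb{Z})$, viewed as a chain in $\mathsf{M}_{2k+1}$ by identifying the vertex $\bar{j}$ with $k+j$, and let $\gamma^{(2k+1)}$ be obtained from (a cycle representing) $\gamma$ by replacing each vertex $i\in[n]$ by $i+2k+1$. If $(z_{k_0,k_0+1}\wedge\gamma^{(2k_0+1)})\otimes 1$ is nonzero in $\tilde{H}_{k_0-1+d}(\mathsf{M}_{2k_0+1+n};\mathbb{Z})\otimes\mathbb{Z}_p$, then $(z_{k,k+1}\wedge\gamma^{(2k+1)})\otimes 1$ is nonzero in $\tilde{H}_{k-1+d}(\mathsf{M}_{2k+1+n};\mathbb{Z})\otimes\mathbb{Z}_p$ for all $k\ge k_0$.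
   Context: $\mathsf{M}_N$ is the matching complex: the simplicial complex of matchings (sets of pairwise vertex-disjoint edges) in the complete graph on $[N]=\{1,\dots,N\}$. $\mathsf{M}_{k,k+1}$ is the chessboard complex of matchings in the complete bipartite graph with blocks $[k]$ and $\{\bar1,\dots,\overline{k+1}\}$, edges written $i\bar j$. $\mathfrak{S}_{[k+1]}$ is the symmetric group on $[k+1]$. Homology is reduced simplicial homology; a face $\{e_0,\dots,e_d\}$ gives the chain $e_0\wedge\cdots\wedge e_d$, and for chains on disjoint vertex sets $c\wedge c'$ is the bilinear extension of concatenation (join of chains); the wedge of two cycles is a cycle. -}

module Defs where

open import Data.Nat as ℕ using (ℕ; zero; suc; _+_; _≤_; _<_; _<ᵇ_; _≡ᵇ_)
open import Data.Integer as ℤ using (ℤ; -_) renaming (_+_ to _+ℤ_; _*_ to _*ℤ_)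
open import Data.Bool using (Bool; true; false; if_then_else_; not; _∧_)
open import Data.List using (List; []; _∷_; _++_; map; concatMap; length; filter; zipWith; foldr)
open import Data.Bool.ListAction using (any)
open import Data.List.Relation.Unary.All using (All)
open import Data.List.Relation.Unary.AllPairs using (AllPairs)
open import Data.Maybe using (Maybe; just; nothing)
open import Data.Product using (_×_; _,_; ∃; ∃-syntax; proj₁; proj₂)
open import Relation.Binary.PropositionalEquality using (_≡_; _≢_)

-- Vertices are natural numbers; the vertex set of M_N is [N] = {1,…,N}.
-- An edge {i,j} is stored canonically as the pair (i , j) with i < j.

Edge : Set
Edge = ℕ × ℕ

_==E_ : Edge → Edge → Bool
(a , b) ==E (c , d) = (a ≡ᵇ c) ∧ (b ≡ᵇ d)

Disjoint : Edge → Edge → Set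
Disjoint (a , b) (c , d) = (a ≢ c) × (a ≢ d) × (b ≢ c) × (b ≢ d)

EdgeIn : ℕ → Edge → Set
EdgeIn N (i , j) = (1 ≤ i) × (i < j) × (j ≤ N)

-- An (ordered) list of edges forms a face of M_N: edges of K_N,
-- pairwise vertex-disjoint.
IsMatching : ℕ → List Edge → Set
IsMatching N es = All (EdgeIn N) es × AllPairs Disjoint es

-- A term (a , es) stands for a · (e₀ ∧ ⋯ ∧ e_q) where es = e₀ ∷ ⋯ ∷ e_q.
-- Reduced chains: the empty list of edges is the empty face (degree -1).

Chain : Set
Chain = List (ℤ × List Edge)

ChainIn : ℕ → Chain → Set
ChainIn N c = All (λ t → IsMatching N (proj₂ t)) c

-- every term has exactly m edges (i.e. c ∈ C̃_{m-1})
HasSize : ℕ → Chain → Set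
HasSize m c = All (λ t → length (proj₂ t) ≡ m) c

_⊕_ : Chain → Chain → Chain
c ⊕ c' = c ++ c'

scale : ℤ → Chain → Chain
scale k c = map (λ t → (k *ℤ proj₁ t , proj₂ t)) c

_∧ᶜ_ : Chain → Chain → Chain
c ∧ᶜ c' = concatMap (λ t → map (λ t' → (proj₁ t *ℤ proj₁ t' , proj₂ t ++ proj₂ t')) c') c

bdTerm : ℤ → List Edge → Chain
bdTerm a [] = []
bdTerm a (e ∷ es) = (a , es) ∷ map (λ t → (proj₁ t , e ∷ proj₂ t)) (bdTerm (- a) es)

∂ : Chain → Chain
∂ c = concatMap (λ t → bdTerm (proj₁ t) (proj₂ t)) c

-- Equality of chains in the oriented chain group: e_{π(0)} ∧ ⋯ = sgn π · e₀ ∧ ⋯,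
-- and terms with a repeated edge vanish.  We compare coefficients on every
-- ordered face σ.

sign : ℕ → ℤ
sign zero = ℤ.+ 1
sign (suc n) = - sign n

inversions : List ℕ → ℕ
inversions [] = 0
inversions (x ∷ xs) = length (filter (λ y → y ℕ.<? x) xs) + inversions xs

noDup : List ℕ → Bool
noDup [] = true
noDup (x ∷ xs) = not (any (λ y → x ≡ᵇ y) xs) ∧ noDup xs

indexOf : Edge → List Edge → Maybe ℕ
indexOf e [] = nothing
indexOf e (f ∷ fs) with e ==E f
... | true = just 0
... | false with indexOf e fs
...   | just i = just (suc i)
...   | nothing = nothing

indices : List Edge → List Edge → Maybe (List ℕ)
indices σ [] = just []
indices σ (e ∷ es) with indexOf e σ | indices σ es
... | just i | just is = just (i ∷ is)
... | _ | _ = nothing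

-- relSign es σ = sgn π if es is the rearrangement of σ by the permutation π
-- (all edges distinct), and 0 otherwise.
relSign : List Edge → List Edge → ℤ
relSign es σ with length es ≡ᵇ length σ | indices σ es
... | true | just is = if noDup is then sign (inversions is) else ℤ.+ 0
... | _ | _ = ℤ.+ 0

sumℤ : List ℤ → ℤ
sumℤ = foldr _+ℤ_ (ℤ.+ 0)

coeff : Chain → List Edge → ℤ
coeff c σ = sumℤ (map (λ t → proj₁ t *ℤ relSign (proj₂ t) σ) c)

_≈ᶜ_ : Chain → Chain → Set
c ≈ᶜ c' = ∀ σ → coeff c σ ≡ coeff c' σ

IsCycle : Chain → Set
IsCycle c = ∂ c ≈ᶜ []

-- [z] ⊗ 1 = 0 in H̃_{m-1}(M_N;ℤ) ⊗ ℤ_p  ≅  H̃_{m-1}(M_N;ℤ) / p·H̃_{m-1}(M_N;ℤ),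
-- i.e. z = ∂b + p·w for a chain b ∈ C̃_m(M_N) and a cycle w ∈ C̃_{m-1}(M_N).

VanishesModP : (N m p : ℕ) → Chain → Set
VanishesModP N m p z =
  ∃[ b ] ∃[ w ] (ChainIn N b × HasSize (suc m) b × ChainIn N w × HasSize m w
                 × IsCycle w × (z ≈ᶜ (∂ b ⊕ scale (ℤ.+ p) w)))

insertEverywhere : ℕ → List ℕ → List (List ℕ)
insertEverywhere x [] = (x ∷ []) ∷ []
insertEverywhere x (y ∷ ys) = (x ∷ y ∷ ys) ∷ map (y ∷_) (insertEverywhere x ys)

perms : List ℕ → List (List ℕ)
perms [] = [] ∷ []
perms (x ∷ xs) = concatMap (insertEverywhere x) (perms xs)

range : ℕ → ℕ → List ℕ
range a zero = []
range a (suc n) = a ∷ range (suc a) n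

sgn : List ℕ → ℤ
sgn π = sign (inversions π)

zChain : ℕ → Chain
zChain k = map (λ π → (sgn π , zipWith (λ i πi → (i , k + πi)) (range 1 k) π))
               (perms (range 1 (suc k)))

shift : ℕ → Chain → Chain
shift s c = map (λ t → (proj₁ t , map (λ e → (proj₁ e + s , proj₂ e + s)) (proj₂ t))) c

-- Deleting the edge e = {1, k+2} (that is, 1 1̄ in M_{k+1,k+2}) gives a map from chains of
-- M_{N+2} to chains of M_N: a face containing e at position j goes to (-1)^j times the face
-- without e, its vertices renumbered order-preservingly from [N+2] ∖ {1, k+2} onto [N]; every
-- other face goes to 0.  On chains of matchings this anticommutes with ∂, and the coefficient of
-- a face τ in the image equals the coefficient of e ∧ τ' in the source, τ' the renumbered τ.
-- The terms of z_{k+1,k+2} containing e are exactly those with π(1) = 1, so the map sends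
-- z_{k+1,k+2} ∧ γ^(2k+3) to z_{k,k+1} ∧ γ^(2k+1).  Applied to z ∧ γ = ∂b + p·w it shows that
-- vanishing in H̃ ⊗ ℤ_p descends from k + 1 to k, which is the contrapositive of the claim.

module Submission where

open import Defs
open import Data.Nat using (ℕ; _+_; _*_; _≤_)
open import Data.Nat.Primality using (Prime)
open import Relation.Nullary using (¬_)

open import Data.Nat as ℕ using (zero; suc; _<_; _∸_; _≡ᵇ_; z≤n; s≤s)
import Data.Nat.Properties as ℕ
open import Data.Nat.Tactic.RingSolver using (solve-∀)
open import Data.Integer as ℤ using (ℤ; -_) renaming (_+_ to _+ℤ_; _*_ to _*ℤ_)
import Data.Integer.Properties as ℤ
open import Algebra.Properties.CommutativeSemigroup ℕ.+-commutativeSemigroup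
  using () renaming (x∙yz≈y∙xz to +-left-comm)
open import Algebra.Properties.CommutativeSemigroup ℤ.*-commutativeSemigroup
  using () renaming (xy∙z≈xz∙y to *-right-comm)
open import Data.Bool using (Bool; true; false; if_then_else_; not; _∧_; _∨_; T)
import Data.Bool.Properties as Bool
open import Data.Bool.ListAction using (any)
open import Data.List using (List; []; _∷_; _++_; map; concat; concatMap; length; filter; zipWith)
import Data.List.Properties as List
open import Data.List.Relation.Unary.All as All using (All; []; _∷_)
import Data.List.Relation.Unary.All.Properties as All
import Data.List.Relation.Unary.Any as Any
import Data.List.Relation.Unary.Any.Properties as Any
open import Data.List.Membership.Propositional using (_∈_)
open import Data.List.Relation.Unary.AllPairs using (AllPairs; []; _∷_)
open import Data.List.Relation.Binary.Sublist.Propositional using (_⊆_; []; _∷_; _∷ʳ_; ⊆-refl)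
open import Data.List.Relation.Binary.Sublist.Propositional.Properties using (All-resp-⊆)
open import Data.List.Relation.Unary.Unique.Propositional using (Unique)
import Data.List.Relation.Unary.Unique.Propositional.Properties as Unique
open import Data.Maybe as Maybe using (Maybe; just; nothing; maybe′)
open import Data.Product using (_×_; _,_; proj₁; proj₂; uncurry)
open import Data.Product.Properties using (,-injective)
open import Data.Sum using (inj₁; inj₂)
open import Function using (_∘_)
open import Function.Bundles using (mk⇔)
open import Relation.Nullary using (Dec; yes; no; does; contradiction)
open import Relation.Nullary.Decidable using (map′; _×-dec_; dec-true; dec-false; does-⇔)
open import Relation.Binary.PropositionalEquality

sign-+ : ∀ m n → sign (m + n) ≡ sign m *ℤ sign n
sign-+ zero    n = sym (ℤ.*-identityˡ (sign n))
sign-+ (suc m) n = trans (cong -_ (sign-+ m n)) (ℤ.neg-distribˡ-* (sign m) (sign n))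

_≟E_ : (f g : Edge) → Dec (f ≡ g)
(a , b) ≟E (c , d) = map′ (uncurry (cong₂ _,_)) ,-injective ((a ℕ.≟ c) ×-dec (b ℕ.≟ d))

==E-true : ∀ {f g} → f ≡ g → (f ==E g) ≡ true
==E-true {f} {g} = dec-true (f ≟E g)

==E-false : ∀ {f g} → f ≢ g → (f ==E g) ≡ false
==E-false {f} {g} = dec-false (f ≟E g)

==E⇒≡ : ∀ {f g} → (f ==E g) ≡ true → f ≡ g
==E⇒≡ {f} {g} eq with f ≟E g
... | yes f≡g = f≡g
... | no  f≢g = contradiction (trans (sym eq) (dec-false (f ≟E g) f≢g)) λ ()

negate : Chain → Chain
negate = map (λ t → (- proj₁ t , proj₂ t))

prepend : Edge → Chain → Chain
prepend f = map (λ t → (proj₁ t , f ∷ proj₂ t))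

_∧ᵗ_ : ℤ × List Edge → Chain → Chain
(a , es) ∧ᵗ c = map (λ t → (a *ℤ proj₁ t , es ++ proj₂ t)) c

coeff-++ : ∀ c c' σ → coeff (c ++ c') σ ≡ coeff c σ +ℤ coeff c' σ
coeff-++ []             c' σ = sym (ℤ.+-identityˡ _)
coeff-++ ((a , es) ∷ c) c' σ =
  trans (cong (a *ℤ relSign es σ +ℤ_) (coeff-++ c c' σ))
        (sym (ℤ.+-assoc (a *ℤ relSign es σ) (coeff c σ) (coeff c' σ)))

coeff-negate : ∀ c σ → coeff (negate c) σ ≡ - coeff c σ
coeff-negate []             σ = refl
coeff-negate ((a , es) ∷ c) σ = begin
  - a *ℤ relSign es σ +ℤ coeff (negate c) σ  ≡⟨ cong₂ _+ℤ_ (sym (ℤ.neg-distribˡ-* a _)) (coeff-negate c σ) ⟩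
  - (a *ℤ relSign es σ) +ℤ - coeff c σ       ≡⟨ ℤ.neg-distrib-+ (a *ℤ relSign es σ) (coeff c σ) ⟨
  - (a *ℤ relSign es σ +ℤ coeff c σ)         ∎
  where open ≡-Reasoning

negate-involutive : ∀ c → negate (negate c) ≡ c
negate-involutive []             = refl
negate-involutive ((a , es) ∷ c) =
  cong₂ _∷_ (cong (_, es) (ℤ.neg-involutive a)) (negate-involutive c)

negate-++ : ∀ c c' → negate (c ++ c') ≡ negate c ++ negate c'
negate-++ = List.map-++ _

negate-prepend : ∀ f c → negate (prepend f c) ≡ prepend f (negate c)
negate-prepend f c = trans (sym (List.map-∘ c)) (List.map-∘ c)

bdTerm-neg : ∀ a es → bdTerm (- a) es ≡ negate (bdTerm a es)
bdTerm-neg a []       = refl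
bdTerm-neg a (f ∷ es) = cong ((- a , es) ∷_)
  (trans (cong (prepend f) (bdTerm-neg (- a) es)) (sym (negate-prepend f (bdTerm (- a) es))))

∂-++ : ∀ c c' → ∂ (c ++ c') ≡ ∂ c ++ ∂ c'
∂-++ = List.concatMap-++ _

∂-negate : ∀ c → ∂ (negate c) ≡ negate (∂ c)
∂-negate []             = refl
∂-negate ((a , es) ∷ c) =
  trans (cong₂ _++_ (bdTerm-neg a es) (∂-negate c)) (sym (negate-++ (bdTerm a es) (∂ c)))

AllPairs-resp-⊆ : ∀ {R : Edge → Edge → Set} {xs ys} → xs ⊆ ys → AllPairs R ys → AllPairs R xs
AllPairs-resp-⊆ []         []       = []
AllPairs-resp-⊆ (_ ∷ʳ p)   (_ ∷ rs) = AllPairs-resp-⊆ p rs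
AllPairs-resp-⊆ (refl ∷ p) (r ∷ rs) = All-resp-⊆ p r ∷ AllPairs-resp-⊆ p rs

IsMatching-resp-⊆ : ∀ {N xs ys} → xs ⊆ ys → IsMatching N ys → IsMatching N xs
IsMatching-resp-⊆ p (edges , disjoint) = All-resp-⊆ p edges , AllPairs-resp-⊆ p disjoint

bdTerm-⊆ : ∀ a es → All (λ t → proj₂ t ⊆ es) (bdTerm a es)
bdTerm-⊆ a []       = []
bdTerm-⊆ a (f ∷ es) = (f ∷ʳ ⊆-refl) ∷ All.map⁺ (All.map (refl ∷_) (bdTerm-⊆ (- a) es))

∂-ChainIn : ∀ {N} c → ChainIn N c → ChainIn N (∂ c)
∂-ChainIn {N} c hc = All.concat⁺ (All.map⁺ (All.map faces hc))
  where
  faces : ∀ {t} → IsMatching N (proj₂ t) → All (λ s → IsMatching N (proj₂ s)) (bdTerm (proj₁ t) (proj₂ t))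
  faces {a , es} m = All.map (λ s → IsMatching-resp-⊆ s m) (bdTerm-⊆ a es)

insertAt : ℕ → ℕ → List ℕ → List ℕ
insertAt zero    x ys       = x ∷ ys
insertAt (suc j) x []       = x ∷ []
insertAt (suc j) x (y ∷ ys) = y ∷ insertAt j x ys

any-insertAt : ∀ (p : ℕ → Bool) j x ys → any p (insertAt j x ys) ≡ p x ∨ any p ys
any-insertAt p zero    x ys       = refl
any-insertAt p (suc j) x []       = refl
any-insertAt p (suc j) x (y ∷ ys) = begin
  p y ∨ any p (insertAt j x ys)  ≡⟨ cong (p y ∨_) (any-insertAt p j x ys) ⟩
  p y ∨ (p x ∨ any p ys)         ≡⟨ Bool.∨-assoc (p y) (p x) (any p ys) ⟨
  (p y ∨ p x) ∨ any p ys         ≡⟨ cong (_∨ any p ys) (Bool.∨-comm (p y) (p x)) ⟩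
  (p x ∨ p y) ∨ any p ys         ≡⟨ Bool.∨-assoc (p x) (p y) (any p ys) ⟩
  p x ∨ (p y ∨ any p ys)         ∎
  where open ≡-Reasoning

any-≡ᵇ-map-suc : ∀ x ys → any (suc x ≡ᵇ_) (map suc ys) ≡ any (x ≡ᵇ_) ys
any-≡ᵇ-map-suc x []       = refl
any-≡ᵇ-map-suc x (y ∷ ys) = cong ((x ≡ᵇ y) ∨_) (any-≡ᵇ-map-suc x ys)

any-0≡ᵇ-map-suc : ∀ ys → any (0 ≡ᵇ_) (map suc ys) ≡ false
any-0≡ᵇ-map-suc []       = refl
any-0≡ᵇ-map-suc (y ∷ ys) = any-0≡ᵇ-map-suc ys

noDup-map-suc : ∀ is → noDup (map suc is) ≡ noDup is
noDup-map-suc []       = refl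
noDup-map-suc (i ∷ is) = cong₂ (λ a b → not a ∧ b) (any-≡ᵇ-map-suc i is) (noDup-map-suc is)

noDup-insertAt-0 : ∀ j is → noDup (insertAt j 0 (map suc is)) ≡ noDup is
noDup-insertAt-0 zero    is       =
  trans (cong (λ a → not a ∧ noDup (map suc is)) (any-0≡ᵇ-map-suc is)) (noDup-map-suc is)
noDup-insertAt-0 (suc j) []       = refl
noDup-insertAt-0 (suc j) (i ∷ is) = cong₂ (λ a b → not a ∧ b)
  (trans (any-insertAt (suc i ≡ᵇ_) j 0 (map suc is)) (any-≡ᵇ-map-suc i is))
  (noDup-insertAt-0 j is)

smaller : ℕ → List ℕ → ℕ
smaller x ys = length (filter (λ y → y ℕ.<? x) ys)

smaller-map-suc : ∀ x ys → smaller (suc x) (map suc ys) ≡ smaller x ys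
smaller-map-suc x []       = refl
smaller-map-suc x (y ∷ ys) with does (y ℕ.<? x)
... | true  = cong suc (smaller-map-suc x ys)
... | false = smaller-map-suc x ys

smaller-0 : ∀ ys → smaller 0 ys ≡ 0
smaller-0 []       = refl
smaller-0 (y ∷ ys) = smaller-0 ys

smaller-insertAt-0 : ∀ x j ys → smaller (suc x) (insertAt j 0 ys) ≡ suc (smaller (suc x) ys)
smaller-insertAt-0 x zero    ys       = refl
smaller-insertAt-0 x (suc j) []       = refl
smaller-insertAt-0 x (suc j) (y ∷ ys) with does (y ℕ.<? suc x)
... | true  = cong suc (smaller-insertAt-0 x j ys)
... | false = smaller-insertAt-0 x j ys

inversions-map-suc : ∀ is → inversions (map suc is) ≡ inversions is
inversions-map-suc []       = refl
inversions-map-suc (i ∷ is) = cong₂ _+_ (smaller-map-suc i is) (inversions-map-suc is)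

inversions-insertAt-0 : ∀ j is → j ≤ length is → inversions (insertAt j 0 (map suc is)) ≡ j + inversions is
inversions-insertAt-0 zero    is       _         =
  cong₂ _+_ (smaller-0 (map suc is)) (inversions-map-suc is)
inversions-insertAt-0 (suc j) (i ∷ is) (s≤s j≤) = begin
  smaller (suc i) (insertAt j 0 (map suc is)) + inversions (insertAt j 0 (map suc is))
    ≡⟨ cong₂ _+_ (trans (smaller-insertAt-0 i j (map suc is)) (cong suc (smaller-map-suc i is)))
                 (inversions-insertAt-0 j is j≤) ⟩
  suc (smaller i is) + (j + inversions is)
    ≡⟨ cong suc (+-left-comm (smaller i is) j (inversions is)) ⟩
  suc j + (smaller i is + inversions is)
    ∎
  where open ≡-Reasoning

permSign : List ℕ → ℤ
permSign is = if noDup is then sign (inversions is) else ℤ.+ 0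

permSign-insertAt-0 : ∀ j is → j ≤ length is → permSign (insertAt j 0 (map suc is)) ≡ sign j *ℤ permSign is
permSign-insertAt-0 j is j≤ rewrite noDup-insertAt-0 j is | inversions-insertAt-0 j is j≤ with noDup is
... | true  = sign-+ j (inversions is)
... | false = sym (ℤ.*-zeroʳ (sign j))

noDup⇒Unique : ∀ is → noDup is ≡ true → Unique is
noDup⇒Unique []       _  = []
noDup⇒Unique (i ∷ is) nd = All.tabulate i∉is ∷ noDup⇒Unique is (Bool.∧-conicalʳ _ _ nd)
  where
  i∉is : ∀ {j} → j ∈ is → i ≢ j
  i∉is j∈is refl = subst T (Bool.not-injective (Bool.∧-conicalˡ _ _ nd))
    (Any.any⁺ (i ≡ᵇ_) (Any.map (λ { refl → ℕ.≡⇒≡ᵇ i i refl }) j∈is))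

Unique⇒length≤ : ∀ m {xs} → Unique xs → All (_< m) xs → length xs ≤ m
Unique⇒length≤ zero    {[]}    _ _        = z≤n
Unique⇒length≤ zero    {_ ∷ _} _ (() ∷ _)
Unique⇒length≤ (suc m) {xs}    u xs<1+m   = ℕ.≤-trans (atMostOneEqualsM xs u xs<1+m)
  (s≤s (Unique⇒length≤ m (Unique.filter⁺ (ℕ._<? m) u) (All.all-filter (ℕ._<? m) xs)))
  where
  atMostOneEqualsM : ∀ xs → Unique xs → All (_< suc m) xs → length xs ≤ suc (length (filter (ℕ._<? m) xs))
  atMostOneEqualsM []       _         _               = z≤n
  atMostOneEqualsM (x ∷ xs) (x∉ ∷ u) (x<1+m ∷ xs<1+m) with x ℕ.<? m
  ... | yes x<m rewrite List.filter-accept (ℕ._<? m) {xs = xs} x<m = s≤s (atMostOneEqualsM xs u xs<1+m)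
  ... | no  x≮m rewrite List.filter-reject (ℕ._<? m) {xs = xs} x≮m =
    s≤s (ℕ.≤-reflexive (sym (cong length (List.filter-all (ℕ._<? m) (All.zipWith below (x∉ , xs<1+m))))))
    where
    below : ∀ {y} → x ≢ y × y < suc m → y < m
    below (x≢y , y<1+m) = ℕ.≤∧≢⇒< (ℕ.≤-pred y<1+m)
      λ y≡m → x≢y (trans (ℕ.≤-antisym (ℕ.≤-pred x<1+m) (ℕ.≮⇒≥ x≮m)) (sym y≡m))

indexOf-∷ : ∀ x f fs → indexOf x (f ∷ fs) ≡ (if x ==E f then just 0 else Maybe.map suc (indexOf x fs))
indexOf-∷ x f fs with x ==E f
... | true  = refl
... | false with indexOf x fs
...   | just i  = refl
...   | nothing = refl

indices-∷ : ∀ σ f fs → indices σ (f ∷ fs) ≡ Maybe.zipWith _∷_ (indexOf f σ) (indices σ fs)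
indices-∷ σ f fs with indexOf f σ | indices σ fs
... | just i  | just is = refl
... | just i  | nothing = refl
... | nothing | _       = refl

relSign-unfold : ∀ es σ →
  relSign es σ ≡ (if length es ≡ᵇ length σ then maybe′ permSign (ℤ.+ 0) (indices σ es) else ℤ.+ 0)
relSign-unfold es σ with length es ≡ᵇ length σ | indices σ es
... | true  | just is = refl
... | true  | nothing = refl
... | false | _       = refl

indexOf<length : ∀ x σ {i} → indexOf x σ ≡ just i → i < length σ
indexOf<length x (f ∷ σ) eq rewrite indexOf-∷ x f σ with x ==E f | indexOf x σ in found
indexOf<length x (f ∷ σ) refl | true  | _      = s≤s z≤n
indexOf<length x (f ∷ σ) refl | false | just i = s≤s (indexOf<length x σ found)

indices-length : ∀ σ es {is} → indices σ es ≡ just is → length is ≡ length es × All (_< length σ) is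
indices-length σ []       refl = refl , []
indices-length σ (f ∷ es) eq rewrite indices-∷ σ f es with indexOf f σ in found | indices σ es in rest
indices-length σ (f ∷ es) refl | just i | just is =
  cong suc (proj₁ (indices-length σ es rest)) , indexOf<length f σ found ∷ proj₂ (indices-length σ es rest)

-- Permutations of a range

concatMap-concatMap : ∀ {A B C : Set} (g : B → List C) (h : A → List B) xs →
                      concatMap g (concatMap h xs) ≡ concatMap (concatMap g ∘ h) xs
concatMap-concatMap g h []       = refl
concatMap-concatMap g h (x ∷ xs) =
  trans (List.concatMap-++ g (h x) (concatMap h xs)) (cong (concatMap g (h x) ++_) (concatMap-concatMap g h xs))

range-suc : ∀ a n → range (suc a) n ≡ map suc (range a n)
range-suc a zero    = refl
range-suc a (suc n) = cong (suc a ∷_) (range-suc (suc a) n)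

range-≥ : ∀ a n → All (a ≤_) (range a n)
range-≥ a zero    = []
range-≥ a (suc n) = ℕ.≤-refl ∷ All.map ℕ.<⇒≤ (range-≥ (suc a) n)

insertEverywhere-map : ∀ (f : ℕ → ℕ) x ys →
                       insertEverywhere (f x) (map f ys) ≡ map (map f) (insertEverywhere x ys)
insertEverywhere-map f x []       = refl
insertEverywhere-map f x (y ∷ ys) = cong ((f x ∷ f y ∷ map f ys) ∷_)
  (trans (cong (map (f y ∷_)) (insertEverywhere-map f x ys))
         (trans (sym (List.map-∘ (insertEverywhere x ys))) (List.map-∘ (insertEverywhere x ys))))

perms-map : ∀ (f : ℕ → ℕ) xs → perms (map f xs) ≡ map (map f) (perms xs)
perms-map f []       = refl
perms-map f (x ∷ xs) = begin
  concatMap (insertEverywhere (f x)) (perms (map f xs))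
    ≡⟨ cong (concatMap _) (perms-map f xs) ⟩
  concatMap (insertEverywhere (f x)) (map (map f) (perms xs))
    ≡⟨ List.concatMap-map _ (map f) (perms xs) ⟩
  concatMap (insertEverywhere (f x) ∘ map f) (perms xs)
    ≡⟨ List.concatMap-cong (insertEverywhere-map f x) (perms xs) ⟩
  concatMap (map (map f) ∘ insertEverywhere x) (perms xs)
    ≡⟨ List.map-concatMap (map f) (insertEverywhere x) (perms xs) ⟨
  map (map f) (perms (x ∷ xs))
    ∎
  where open ≡-Reasoning

insertEverywhere-All : ∀ {P : ℕ → Set} {x ys} → P x → All P ys → All (All P) (insertEverywhere x ys)
insertEverywhere-All {ys = []}     px []         = (px ∷ []) ∷ []
insertEverywhere-All {ys = y ∷ ys} px (py ∷ pys) =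
  (px ∷ py ∷ pys) ∷ All.map⁺ (All.map (py ∷_) (insertEverywhere-All px pys))

perms-All : ∀ {P : ℕ → Set} {xs} → All P xs → All (All P) (perms xs)
perms-All []         = [] ∷ []
perms-All (px ∷ pxs) = All.concat⁺ (All.map⁺ (All.map (insertEverywhere-All px) (perms-All pxs)))

rows : ℕ → ℕ → ℕ → List ℕ → List Edge
rows m a n = zipWith (λ i πi → (i , m + πi)) (range a n)

zTerm : ℕ → List ℕ → ℤ × List Edge
zTerm k π = sgn π , rows k 1 k π

sgn-1∷map-suc : ∀ ρ → sgn (1 ∷ map suc ρ) ≡ sgn ρ
sgn-1∷map-suc ρ = cong sign (cong₂ _+_ (trans (smaller-map-suc 0 ρ) (smaller-0 ρ)) (inversions-map-suc ρ))

concatMap-[] : ∀ {A B : Set} {f : A → List B} → (∀ x → f x ≡ []) → ∀ xs → concatMap f xs ≡ []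
concatMap-[] f≡[] []       = refl
concatMap-[] f≡[] (x ∷ xs) = cong₂ _++_ (f≡[] x) (concatMap-[] f≡[] xs)

-- The permutations of [n+1] are those of [2, n+1] with 1 inserted somewhere, 1 in front first.
liftedPerms : List ℕ → List (List ℕ)
liftedPerms ρ = insertEverywhere 1 (map suc ρ)

perms-range : ∀ n → perms (range 1 (suc n)) ≡ concatMap liftedPerms (perms (range 1 n))
perms-range n = begin
  concatMap (insertEverywhere 1) (perms (range 2 n))
    ≡⟨ cong (concatMap _ ∘ perms) (range-suc 1 n) ⟩
  concatMap (insertEverywhere 1) (perms (map suc (range 1 n)))
    ≡⟨ cong (concatMap _) (perms-map suc (range 1 n)) ⟩
  concatMap (insertEverywhere 1) (map (map suc) (perms (range 1 n)))
    ≡⟨ List.concatMap-map (insertEverywhere 1) (map suc) (perms (range 1 n)) ⟩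
  concatMap liftedPerms (perms (range 1 n))
    ∎
  where open ≡-Reasoning

z∧-decomposition : ∀ n c → zChain (suc n) ∧ᶜ c ≡
                   concatMap (concatMap (λ π → zTerm (suc n) π ∧ᵗ c) ∘ liftedPerms) (perms (range 1 (suc n)))
z∧-decomposition n c = begin
  zChain (suc n) ∧ᶜ c                              ≡⟨ List.concatMap-map (_∧ᵗ c) (zTerm (suc n)) Q ⟩
  concatMap Z Q                                    ≡⟨ cong (concatMap Z) (perms-range (suc n)) ⟩
  concatMap Z (concatMap liftedPerms P)            ≡⟨ concatMap-concatMap Z liftedPerms P ⟩
  concatMap (concatMap Z ∘ liftedPerms) P          ∎
  where
  P Q : List (List ℕ)
  P = perms (range 1 (suc n))
  Q = perms (range 1 (suc (suc n)))
  Z : List ℕ → Chain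
  Z π = zTerm (suc n) π ∧ᵗ c
  open ≡-Reasoning

-- Deleting an edge from a face

module Pick (e : Edge) where

  pick : List Edge → Maybe (ℕ × List Edge)
  pick []       = nothing
  pick (f ∷ fs) = if f ==E e then just (0 , fs) else Maybe.map (λ (j , r) → suc j , f ∷ r) (pick fs)

  Fresh : List Edge → Set
  Fresh = All (λ f → (f ==E e) ≡ false)

  Fresh⇒pick≡nothing : ∀ {es} → Fresh es → pick es ≡ nothing
  Fresh⇒pick≡nothing []                  = refl
  Fresh⇒pick≡nothing {f ∷ fs} (f≠e ∷ fr) rewrite f≠e | Fresh⇒pick≡nothing fr = refl

  pick≡nothing⇒Fresh : ∀ es → pick es ≡ nothing → Fresh es
  pick≡nothing⇒Fresh []       _  = []
  pick≡nothing⇒Fresh (f ∷ fs) eq with f ==E e in f≟e | pick fs in rest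
  ... | false | nothing = f≟e ∷ pick≡nothing⇒Fresh fs rest

  pick-length : ∀ es {j r} → pick es ≡ just (j , r) → length es ≡ suc (length r) × j ≤ length r
  pick-length (f ∷ fs) eq with f ==E e | pick fs in rest
  pick-length (f ∷ fs) refl | true  | _      = refl , z≤n
  pick-length (f ∷ fs) refl | false | just _ =
    cong suc (proj₁ (pick-length fs rest)) , s≤s (proj₂ (pick-length fs rest))

  pick-All : ∀ {P : Edge → Set} {es j r} → All P es → pick es ≡ just (j , r) → P e × All P r
  pick-All {P} {f ∷ fs} (pf ∷ pfs) eq with f ==E e in f≟e | pick fs in rest
  ... | true  | _      with refl ← eq = subst P (==E⇒≡ f≟e) pf , pfs
  ... | false | just _ with refl ← eq = proj₁ (pick-All pfs rest) , pf ∷ proj₂ (pick-All pfs rest)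

  pick-AllPairs : ∀ {R : Edge → Edge → Set} → (∀ {f g} → R f g → R g f) →
                  ∀ {es j r} → AllPairs R es → pick es ≡ just (j , r) → All (R e) r × AllPairs R r
  pick-AllPairs {R} R-sym {f ∷ fs} (rf ∷ rfs) eq with f ==E e in f≟e | pick fs in rest
  ... | true  | _      with refl ← eq = subst (λ x → All (R x) fs) (==E⇒≡ f≟e) rf , rfs
  ... | false | just _ with refl ← eq =
    R-sym (proj₁ (pick-All rf rest)) ∷ proj₁ (pick-AllPairs R-sym rfs rest) ,
    proj₂ (pick-All rf rest) ∷ proj₂ (pick-AllPairs R-sym rfs rest)

  indices-Fresh : ∀ τ {fs} → Fresh fs → indices (e ∷ τ) fs ≡ Maybe.map (map suc) (indices τ fs)
  indices-Fresh τ {[]}     []          = refl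
  indices-Fresh τ {f ∷ fs} (f≠e ∷ fr)
    rewrite indices-∷ (e ∷ τ) f fs | indexOf-∷ f e τ | f≠e | indices-Fresh τ fr | indices-∷ τ f fs
    with indexOf f τ | indices τ fs
  ... | just i  | just is = refl
  ... | just i  | nothing = refl
  ... | nothing | _       = refl

  indices-pick : ∀ τ es {j r} → pick es ≡ just (j , r) → Fresh r →
                 indices (e ∷ τ) es ≡ Maybe.map (insertAt j 0 ∘ map suc) (indices τ r)
  indices-pick τ (f ∷ fs) eq fr rewrite indices-∷ (e ∷ τ) f fs | indexOf-∷ f e τ
    with f ==E e | pick fs in rest
  indices-pick τ (f ∷ fs) refl fr | true | _ rewrite indices-Fresh τ fr with indices τ fs
  ... | just is = refl
  ... | nothing = refl
  indices-pick τ (f ∷ fs) refl (_ ∷ fr) | false | just (j , r)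
    rewrite indices-pick τ fs rest fr | indices-∷ τ f r with indexOf f τ | indices τ r
  ... | just i  | just is = refl
  ... | just i  | nothing = refl
  ... | nothing | _       = refl

  relSign-pick : ∀ τ es {j r} → pick es ≡ just (j , r) → Fresh r → relSign es (e ∷ τ) ≡ sign j *ℤ relSign r τ
  relSign-pick τ es {j} {r} eq fr
    rewrite relSign-unfold es (e ∷ τ) | relSign-unfold r τ | indices-pick τ es eq fr | proj₁ (pick-length es eq)
    with indices τ r in found | length r ≡ᵇ length τ
  ... | nothing | true  = sym (ℤ.*-zeroʳ (sign j))
  ... | nothing | false = sym (ℤ.*-zeroʳ (sign j))
  ... | just is | false = sym (ℤ.*-zeroʳ (sign j))
  ... | just is | true  = permSign-insertAt-0 j is
    (subst (j ≤_) (sym (proj₁ (indices-length τ r found))) (proj₂ (pick-length es eq)))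

  -- The indices of es in e ∷ τ avoid 0, so 1 + length τ of them cannot all be distinct.
  relSign-Fresh : ∀ τ {es} → Fresh es → relSign es (e ∷ τ) ≡ ℤ.+ 0
  relSign-Fresh τ {es} fr rewrite relSign-unfold es (e ∷ τ) | indices-Fresh τ fr
    with indices τ es in found | length es ≡ᵇ suc (length τ) in sameLength
  ... | nothing | true  = refl
  ... | nothing | false = refl
  ... | just is | false = refl
  ... | just is | true rewrite noDup-map-suc is with noDup is in nd
  ...   | false = refl
  ...   | true  = contradiction (Unique⇒length≤ (length τ) (noDup⇒Unique is nd) (proj₂ (indices-length τ es found)))
                                (ℕ.<⇒≱ (ℕ.≤-reflexive (sym |is|≡1+|τ|)))
    where
    |is|≡1+|τ| : length is ≡ suc (length τ)
    |is|≡1+|τ| = trans (proj₁ (indices-length τ es found)) (ℕ.≡ᵇ⇒≡ (length es) _ (subst T (sym sameLength) _))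

  pick-++ : ∀ es gs {j r} → pick es ≡ just (j , r) → pick (es ++ gs) ≡ just (j , r ++ gs)
  pick-++ (f ∷ fs) gs eq with f ==E e
  pick-++ (f ∷ fs) gs refl | true = refl
  ... | false with pick fs in rest
  ...   | just (j , r) with refl ← eq rewrite pick-++ fs gs rest = refl

module Link (e : Edge) (rel : Edge → Edge) where
  open Pick e public

  relabel : Chain → Chain
  relabel = map (λ t → (proj₁ t , map rel (proj₂ t)))

  linkTerm : ℤ × List Edge → Chain
  linkTerm (a , es) = maybe′ (λ (j , r) → (a *ℤ sign j , map rel r) ∷ []) [] (pick es)

  link : Chain → Chain
  link = concatMap linkTerm

  AtMostOnce : List Edge → Set
  AtMostOnce es = ∀ {j r} → pick es ≡ just (j , r) → Fresh r

  link-++ : ∀ c c' → link (c ++ c') ≡ link c ++ link c'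
  link-++ = List.concatMap-++ linkTerm

  relabel-negate : ∀ c → relabel (negate c) ≡ negate (relabel c)
  relabel-negate c = trans (sym (List.map-∘ c)) (List.map-∘ c)

  bdTerm-relabel : ∀ a es → bdTerm a (map rel es) ≡ relabel (bdTerm a es)
  bdTerm-relabel a []       = refl
  bdTerm-relabel a (f ∷ es) = cong ((a , map rel es) ∷_)
    (trans (cong (prepend (rel f)) (bdTerm-relabel (- a) es))
           (trans (sym (List.map-∘ (bdTerm (- a) es))) (List.map-∘ (bdTerm (- a) es))))

  link-prepend-Fresh : ∀ {f} → (f ==E e) ≡ false → ∀ c → link (prepend f c) ≡ prepend (rel f) (negate (link c))
  link-prepend-Fresh f≠e []            = refl
  link-prepend-Fresh {f} f≠e ((b , l) ∷ c) rewrite f≠e with pick l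
  ... | nothing     = link-prepend-Fresh f≠e c
  ... | just (j , r) = cong₂ _∷_ (cong (_, rel f ∷ map rel r) (sym (ℤ.neg-distribʳ-* b (sign j))))
                                 (link-prepend-Fresh f≠e c)

  link-prepend-pivot : ∀ {f} → (f ==E e) ≡ true → ∀ c → link (prepend f c) ≡ relabel c
  link-prepend-pivot f≡e []            = refl
  link-prepend-pivot f≡e ((b , l) ∷ c) rewrite f≡e =
    cong₂ _∷_ (cong (_, _) (ℤ.*-identityʳ b)) (link-prepend-pivot f≡e c)

  link-bdTerm-Fresh : ∀ a {es} → Fresh es → link (bdTerm a es) ≡ []
  link-bdTerm-Fresh a {[]}     _          = refl
  link-bdTerm-Fresh a {f ∷ fs} (f≠e ∷ fr) = begin
    linkTerm (a , fs) ++ link (prepend f (bdTerm (- a) fs))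
      ≡⟨ cong₂ _++_ (cong (maybe′ _ []) (Fresh⇒pick≡nothing fr)) (link-prepend-Fresh f≠e (bdTerm (- a) fs)) ⟩
    prepend (rel f) (negate (link (bdTerm (- a) fs)))
      ≡⟨ cong (prepend (rel f) ∘ negate) (link-bdTerm-Fresh (- a) fr) ⟩
    []
      ∎
    where open ≡-Reasoning

  link-bdTerm-pick : ∀ a es {j r} → pick es ≡ just (j , r) → Fresh r →
                     link (bdTerm a es) ≡ negate (bdTerm (a *ℤ sign j) (map rel r))
  link-bdTerm-pick a (f ∷ fs) eq fr with f ==E e in f≟e
  ... | true with refl ← eq = begin
    linkTerm (a , fs) ++ link (prepend f (bdTerm (- a) fs))
      ≡⟨ cong₂ _++_ (cong (maybe′ _ []) (Fresh⇒pick≡nothing fr)) (link-prepend-pivot f≟e (bdTerm (- a) fs)) ⟩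
    relabel (bdTerm (- a) fs)             ≡⟨ cong relabel (bdTerm-neg a fs) ⟩
    relabel (negate (bdTerm a fs))        ≡⟨ relabel-negate (bdTerm a fs) ⟩
    negate (relabel (bdTerm a fs))        ≡⟨ cong negate (bdTerm-relabel a fs) ⟨
    negate (bdTerm a (map rel fs))        ≡⟨ cong (λ b → negate (bdTerm b (map rel fs))) (ℤ.*-identityʳ a) ⟨
    negate (bdTerm (a *ℤ sign 0) (map rel fs)) ∎
    where open ≡-Reasoning
  ... | false with pick fs in rest
  ...   | just (j , r) with refl ← eq | _ ∷ fr' ← fr = begin
    head ∷ [] ++ link (prepend f (bdTerm (- a) fs))
      ≡⟨ cong (head ∷_) (link-prepend-Fresh f≟e (bdTerm (- a) fs)) ⟩
    head ∷ prepend (rel f) (negate (link (bdTerm (- a) fs)))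
      ≡⟨ cong (λ c → head ∷ prepend (rel f) (negate c)) (link-bdTerm-pick (- a) fs rest fr') ⟩
    head ∷ prepend (rel f) (negate (negate (bdTerm (- a *ℤ s) (map rel r))))
      ≡⟨ cong (λ c → head ∷ prepend (rel f) c) (negate-involutive _) ⟩
    head ∷ prepend (rel f) (bdTerm (- a *ℤ s) (map rel r))
      ≡⟨ cong (λ b → head ∷ prepend (rel f) (bdTerm b (map rel r))) (ℤ.neg-distribˡ-* a s) ⟨
    bdTerm (a *ℤ s) (map rel (f ∷ r))
      ≡⟨ negate-involutive _ ⟨
    negate (negate (bdTerm (a *ℤ s) (map rel (f ∷ r))))
      ≡⟨ cong negate (bdTerm-neg (a *ℤ s) _) ⟨
    negate (bdTerm (- (a *ℤ s)) (map rel (f ∷ r)))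
      ≡⟨ cong (λ b → negate (bdTerm b (map rel (f ∷ r)))) (ℤ.neg-distribʳ-* a s) ⟩
    negate (bdTerm (a *ℤ - s) (map rel (f ∷ r)))
      ∎
    where
    s : ℤ
    s = sign j
    head : ℤ × List Edge
    head = a *ℤ s , map rel r
    open ≡-Reasoning

  link-bdTerm : ∀ a es → AtMostOnce es → link (bdTerm a es) ≡ negate (∂ (linkTerm (a , es)))
  link-bdTerm a es once with pick es in found
  ... | nothing      = link-bdTerm-Fresh a (pick≡nothing⇒Fresh es found)
  ... | just (j , r) = trans (link-bdTerm-pick a es found (once refl))
                             (cong negate (sym (List.++-identityʳ _)))

  link-∂ : ∀ c → All (λ t → AtMostOnce (proj₂ t)) c → link (∂ c) ≡ negate (∂ (link c))
  link-∂ []             []            = refl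
  link-∂ ((a , es) ∷ c) (once ∷ onces) = begin
    link (bdTerm a es ++ ∂ c)                          ≡⟨ link-++ (bdTerm a es) (∂ c) ⟩
    link (bdTerm a es) ++ link (∂ c)                   ≡⟨ cong₂ _++_ (link-bdTerm a es once) (link-∂ c onces) ⟩
    negate (∂ (linkTerm (a , es))) ++ negate (∂ (link c)) ≡⟨ negate-++ (∂ (linkTerm (a , es))) (∂ (link c)) ⟨
    negate (∂ (linkTerm (a , es)) ++ ∂ (link c))       ≡⟨ cong negate (∂-++ (linkTerm (a , es)) (link c)) ⟨
    negate (∂ (link ((a , es) ∷ c)))                   ∎
    where open ≡-Reasoning

  link-∧ᵗ-pick : ∀ a es {j r} → pick es ≡ just (j , r) → ∀ c →
                 link ((a , es) ∧ᵗ c) ≡ (a *ℤ sign j , map rel r) ∧ᵗ relabel c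
  link-∧ᵗ-pick a es found []                               = refl
  link-∧ᵗ-pick a es {j} {r} found ((b , gs) ∷ c) rewrite pick-++ es gs found =
    cong₂ _∷_ (cong₂ _,_ (*-right-comm a b (sign j)) (List.map-++ rel r gs)) (link-∧ᵗ-pick a es found c)

  link-∧ᵗ-Fresh : ∀ a {es} → Fresh es → ∀ c → All (λ t → Fresh (proj₂ t)) c →
                  link ((a , es) ∧ᵗ c) ≡ []
  link-∧ᵗ-Fresh a fr []             []          = refl
  link-∧ᵗ-Fresh a fr ((b , gs) ∷ c) (frg ∷ frc)
    rewrite Fresh⇒pick≡nothing (All.++⁺ fr frg) = link-∧ᵗ-Fresh a fr c frc

  link-HasSize : ∀ m c → HasSize (suc m) c → HasSize m (link c)
  link-HasSize m c hc = All.concat⁺ (All.map⁺ (All.map (λ {t} → linkTerm-HasSize t) hc))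
    where
    linkTerm-HasSize : ∀ t → length (proj₂ t) ≡ suc m → HasSize m (linkTerm t)
    linkTerm-HasSize (a , es) len with pick es in found
    ... | nothing      = []
    ... | just (j , r) =
      trans (List.length-map rel r) (ℕ.suc-injective (trans (sym (proj₁ (pick-length es found))) len)) ∷ []

  link-scale : ∀ m c → link (scale m c) ≡ scale m (link c)
  link-scale m []             = refl
  link-scale m ((a , es) ∷ c) with pick es
  ... | nothing      = link-scale m c
  ... | just (j , r) = cong₂ _∷_ (cong (_, map rel r) (ℤ.*-assoc m a (sign j))) (link-scale m c)

  module Coefficients (lift : Edge → Edge) (rel∘lift : ∀ f → rel (lift f) ≡ f)
                      (pivot-not-kept : lift (rel e) ≢ e) where

    Kept : Edge → Set
    Kept f = lift (rel f) ≡ f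

    Admissible : List Edge → Set
    Admissible es = ∀ {j r} → pick es ≡ just (j , r) → All Kept r

    ==E-rel : ∀ {f} → Kept f → ∀ g → (rel f ==E g) ≡ (f ==E lift g)
    ==E-rel {f} kept g = does-⇔ (mk⇔ (λ p → trans (sym kept) (cong lift p)) (λ q → trans (cong rel q) (rel∘lift g)))
                                (rel f ≟E g) (f ≟E lift g)

    indexOf-rel : ∀ {f} → Kept f → ∀ σ → indexOf (rel f) σ ≡ indexOf f (map lift σ)
    indexOf-rel kept []      = refl
    indexOf-rel {f} kept (g ∷ σ)
      rewrite indexOf-∷ (rel f) g σ | indexOf-∷ f (lift g) (map lift σ) | ==E-rel kept g | indexOf-rel kept σ = refl

    indices-relabel : ∀ {r} → All Kept r → ∀ σ → indices σ (map rel r) ≡ indices (map lift σ) r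
    indices-relabel []                σ = refl
    indices-relabel {f ∷ r} (kept ∷ ks) σ
      rewrite indices-∷ σ (rel f) (map rel r) | indices-∷ (map lift σ) f r
            | indexOf-rel kept σ | indices-relabel ks σ = refl

    relSign-relabel : ∀ {r} → All Kept r → ∀ σ → relSign (map rel r) σ ≡ relSign r (map lift σ)
    relSign-relabel {r} ks σ
      rewrite relSign-unfold (map rel r) σ | relSign-unfold r (map lift σ)
            | List.length-map rel r | List.length-map lift σ | indices-relabel ks σ = refl

    Kept⇒Fresh : ∀ {r} → All Kept r → Fresh r
    Kept⇒Fresh = All.map λ {f} kept → ==E-false {f} {e} λ { refl → pivot-not-kept kept }

    Admissible⇒AtMostOnce : ∀ es → Admissible es → AtMostOnce es
    Admissible⇒AtMostOnce es adm found = Kept⇒Fresh (adm found)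

    coeff-linkTerm : ∀ a es → Admissible es → ∀ σ →
                     coeff (linkTerm (a , es)) σ ≡ a *ℤ relSign es (e ∷ map lift σ)
    coeff-linkTerm a es adm σ with pick es in found
    ... | nothing = sym (trans (cong (a *ℤ_) (relSign-Fresh (map lift σ) (pick≡nothing⇒Fresh es found)))
                               (ℤ.*-zeroʳ a))
    ... | just (j , r) = begin
      a *ℤ sign j *ℤ relSign (map rel r) σ +ℤ ℤ.+ 0  ≡⟨ ℤ.+-identityʳ _ ⟩
      a *ℤ sign j *ℤ relSign (map rel r) σ           ≡⟨ cong (a *ℤ sign j *ℤ_) (relSign-relabel (adm refl) σ) ⟩
      a *ℤ sign j *ℤ relSign r (map lift σ)          ≡⟨ ℤ.*-assoc a (sign j) _ ⟩
      a *ℤ (sign j *ℤ relSign r (map lift σ))        ≡⟨ cong (a *ℤ_) (relSign-pick _ es found (Kept⇒Fresh (adm refl))) ⟨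
      a *ℤ relSign es (e ∷ map lift σ)               ∎
      where open ≡-Reasoning

    coeff-link : ∀ c → All (λ t → Admissible (proj₂ t)) c → ∀ σ →
                 coeff (link c) σ ≡ coeff c (e ∷ map lift σ)
    coeff-link []             []           σ = refl
    coeff-link ((a , es) ∷ c) (adm ∷ adms) σ =
      trans (coeff-++ (linkTerm (a , es)) (link c) σ) (cong₂ _+ℤ_ (coeff-linkTerm a es adm σ) (coeff-link c adms σ))

    Admissible-∧ᵗ-pick : ∀ a {es j r} → pick es ≡ just (j , r) → All Kept r → ∀ c →
                         All (λ t → All Kept (proj₂ t)) c → All (λ t → Admissible (proj₂ t)) ((a , es) ∧ᵗ c)
    Admissible-∧ᵗ-pick a found kr []             []        = []
    Admissible-∧ᵗ-pick a {es} found kr ((b , gs) ∷ c) (kg ∷ kc) = adm ∷ Admissible-∧ᵗ-pick a found kr c kc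
      where
      adm : Admissible (es ++ gs)
      adm eq with refl ← trans (sym (pick-++ es gs found)) eq = All.++⁺ kr kg

    Admissible-∧ᵗ-Fresh : ∀ a {es} → Fresh es → ∀ c →
                          All (λ t → Fresh (proj₂ t)) c → All (λ t → Admissible (proj₂ t)) ((a , es) ∧ᵗ c)
    Admissible-∧ᵗ-Fresh a fr []             []          = []
    Admissible-∧ᵗ-Fresh a {es} fr ((b , gs) ∷ c) (frg ∷ frc) = adm ∷ Admissible-∧ᵗ-Fresh a fr c frc
      where
      adm : Admissible (es ++ gs)
      adm eq with () ← trans (sym (Fresh⇒pick≡nothing (All.++⁺ fr frg))) eq

    link-≈ᶜ : ∀ {c c'} → All (λ t → Admissible (proj₂ t)) c → All (λ t → Admissible (proj₂ t)) c' →
              c ≈ᶜ c' → link c ≈ᶜ link c'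
    link-≈ᶜ {c} {c'} adm adm' c≈c' σ = trans (coeff-link c adm σ) (trans (c≈c' _) (sym (coeff-link c' adm' σ)))

-- Deleting the edge {1, k+2}

shift-suc : ∀ v k → v + (2 * suc k + 1) ≡ suc (suc (v + (2 * k + 1)))
shift-suc = solve-∀

shift-split : ∀ v k → v + (2 * k + 1) ≡ suc k + (v + k)
shift-split = solve-∀

vertices-suc : ∀ k n → 2 * suc k + 1 + n ≡ suc (suc (2 * k + 1 + n))
vertices-suc = solve-∀

vertices-split : ∀ k n → 2 * k + 1 + n ≡ suc k + (k + n)
vertices-split = solve-∀

module Squeeze (k : ℕ) where

  -- squeeze renumbers [N+2] ∖ {1, k+2} onto [N] preserving order; its values at 1 and k+2 are junk.

  squeeze : ℕ → ℕ
  squeeze v with v ℕ.≤? suc k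
  ... | yes _ = v ∸ 1
  ... | no  _ = v ∸ 2

  unsqueeze : ℕ → ℕ
  unsqueeze v with v ℕ.≤? k
  ... | yes _ = suc v
  ... | no  _ = suc (suc v)

  squeeze-≤ : ∀ {v} → v ≤ suc k → squeeze v ≡ v ∸ 1
  squeeze-≤ {v} v≤ with v ℕ.≤? suc k
  ... | yes _ = refl
  ... | no  v≰ = contradiction v≤ v≰

  squeeze-> : ∀ {v} → suc k < v → squeeze v ≡ v ∸ 2
  squeeze-> {v} v> with v ℕ.≤? suc k
  ... | yes v≤ = contradiction v≤ (ℕ.<⇒≱ v>)
  ... | no  _  = refl

  unsqueeze-≤ : ∀ {v} → v ≤ k → unsqueeze v ≡ suc v
  unsqueeze-≤ {v} v≤ with v ℕ.≤? k
  ... | yes _ = refl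
  ... | no  v≰ = contradiction v≤ v≰

  unsqueeze-> : ∀ {v} → k < v → unsqueeze v ≡ suc (suc v)
  unsqueeze-> {v} v> with v ℕ.≤? k
  ... | yes v≤ = contradiction v≤ (ℕ.<⇒≱ v>)
  ... | no  _  = refl

  squeeze∘unsqueeze : ∀ v → squeeze (unsqueeze v) ≡ v
  squeeze∘unsqueeze v with v ℕ.≤? k
  ... | yes v≤ = squeeze-≤ (s≤s v≤)
  ... | no  v≰ = squeeze-> (s≤s (ℕ.m≤n⇒m≤1+n (ℕ.≰⇒> v≰)))

  KeptV : ℕ → Set
  KeptV v = unsqueeze (squeeze v) ≡ v

  keptV : ∀ {v} → 2 ≤ v → v ≢ suc (suc k) → KeptV v
  keptV {suc (suc v)} (s≤s (s≤s _)) v≢ with suc (suc v) ℕ.≤? suc k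
  ... | yes (s≤s v<) = unsqueeze-≤ v<
  ... | no  v≰       =
    unsqueeze-> (ℕ.≤∧≢⇒< (ℕ.≤-pred (ℕ.≤-pred (ℕ.≰⇒> v≰))) (v≢ ∘ cong (suc ∘ suc) ∘ sym))

  squeeze-mono-≤ : ∀ {u v} → u ≤ v → squeeze u ≤ squeeze v
  squeeze-mono-≤ {u} {v} u≤v with u ℕ.≤? suc k | v ℕ.≤? suc k
  ... | yes _  | yes _  = ℕ.∸-monoˡ-≤ 1 u≤v
  ... | yes u≤ | no  v≰ = ℕ.≤-trans (ℕ.∸-monoˡ-≤ 1 u≤) (ℕ.∸-monoˡ-≤ 2 (ℕ.≰⇒> v≰))
  ... | no  u≰ | yes v≤ = contradiction (ℕ.≤-trans u≤v v≤) u≰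
  ... | no  _  | no  _  = ℕ.∸-monoˡ-≤ 2 u≤v

  squeeze-injective : ∀ {u v} → KeptV u → KeptV v → squeeze u ≡ squeeze v → u ≡ v
  squeeze-injective ku kv eq = trans (sym ku) (trans (cong unsqueeze eq) kv)

  squeezeE unsqueezeE : Edge → Edge
  squeezeE   (a , b) = squeeze a , squeeze b
  unsqueezeE (a , b) = unsqueeze a , unsqueeze b

  pivot : Edge
  pivot = 1 , suc (suc k)

  squeezeE∘unsqueezeE : ∀ f → squeezeE (unsqueezeE f) ≡ f
  squeezeE∘unsqueezeE (a , b) = cong₂ _,_ (squeeze∘unsqueeze a) (squeeze∘unsqueeze b)

  pivot-not-kept : unsqueezeE (squeezeE pivot) ≢ pivot
  pivot-not-kept eq = ℕ.1+n≢n (begin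
    suc (suc k)                       ≡⟨ cong proj₂ eq ⟨
    unsqueeze (squeeze (suc (suc k))) ≡⟨ cong unsqueeze (squeeze-> (ℕ.n<1+n (suc k))) ⟩
    unsqueeze k                       ≡⟨ unsqueeze-≤ ℕ.≤-refl ⟩
    suc k                             ∎)
    where open ≡-Reasoning

  open Link pivot squeezeE public
  open Coefficients unsqueezeE squeezeE∘unsqueezeE pivot-not-kept public

  Kept-pair : ∀ {a b} → KeptV a → KeptV b → Kept (a , b)
  Kept-pair = cong₂ _,_

  Kept-avoiding-pivot : ∀ {M g} → EdgeIn M g → Disjoint pivot g → Kept g
  Kept-avoiding-pivot (1≤x , x<y , _) (1≢x , _ , k+2≢x , k+2≢y) =
    Kept-pair (keptV (ℕ.≤∧≢⇒< 1≤x 1≢x) (k+2≢x ∘ sym))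
              (keptV (ℕ.≤-trans (s≤s 1≤x) x<y) (k+2≢y ∘ sym))

  Disjoint-sym : ∀ {f g} → Disjoint f g → Disjoint g f
  Disjoint-sym (a≢c , a≢d , b≢c , b≢d) = ≢-sym a≢c , ≢-sym b≢c , ≢-sym a≢d , ≢-sym b≢d

  pick-IsMatching : ∀ {M es j r} → IsMatching M es → pick es ≡ just (j , r) →
                    All (λ g → EdgeIn M g × Disjoint pivot g) r × AllPairs Disjoint r
  pick-IsMatching (edges , disjoint) found =
    All.zip (proj₂ (pick-All edges found) , proj₁ (pick-AllPairs Disjoint-sym disjoint found)) ,
    proj₂ (pick-AllPairs Disjoint-sym disjoint found)

  Admissible-IsMatching : ∀ {M} es → IsMatching M es → Admissible es
  Admissible-IsMatching es m found = All.map (uncurry Kept-avoiding-pivot) (proj₁ (pick-IsMatching m found))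

  Admissible-ChainIn : ∀ {M} c → ChainIn M c → All (λ t → Admissible (proj₂ t)) c
  Admissible-ChainIn c = All.map λ {t} m {_} {_} → Admissible-IsMatching (proj₂ t) m

  link-∂-ChainIn : ∀ {M} c → ChainIn M c → link (∂ c) ≡ negate (∂ (link c))
  link-∂-ChainIn c hc =
    link-∂ c (All.map (λ {t} m {_} {_} → Admissible⇒AtMostOnce (proj₂ t) (Admissible-IsMatching (proj₂ t) m)) hc)

  EdgeIn-squeeze : ∀ {N g} → suc k ≤ N → EdgeIn (suc (suc N)) g → Disjoint pivot g → EdgeIn N (squeezeE g)
  EdgeIn-squeeze {N} {x , y} k<N x∈@(_ , x<y , y≤N+2) avoid@(1≢x , _) =
    ℕ.n≢0⇒n>0 squeeze-x≢0 ,
    ℕ.≤∧≢⇒< (squeeze-mono-≤ (ℕ.<⇒≤ x<y))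
            (ℕ.<⇒≢ x<y ∘ squeeze-injective (cong proj₁ kept) (cong proj₂ kept)) ,
    ℕ.≤-trans (squeeze-mono-≤ y≤N+2) (ℕ.≤-reflexive (squeeze-> (s≤s (ℕ.m≤n⇒m≤1+n k<N))))
    where
    kept : Kept (x , y)
    kept = Kept-avoiding-pivot x∈ avoid
    squeeze-x≢0 : squeeze x ≢ 0
    squeeze-x≢0 sx≡0 = 1≢x (begin
      1                     ≡⟨ unsqueeze-≤ z≤n ⟨
      unsqueeze 0           ≡⟨ cong unsqueeze sx≡0 ⟨
      unsqueeze (squeeze x) ≡⟨ cong proj₁ kept ⟩
      x                     ∎)
      where open ≡-Reasoning

  Disjoint-squeeze : ∀ {g h} → Kept g → Kept h → Disjoint g h → Disjoint (squeezeE g) (squeezeE h)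
  Disjoint-squeeze kg kh (a≢c , a≢d , b≢c , b≢d) =
    a≢c ∘ squeeze-injective (cong proj₁ kg) (cong proj₁ kh) ,
    a≢d ∘ squeeze-injective (cong proj₁ kg) (cong proj₂ kh) ,
    b≢c ∘ squeeze-injective (cong proj₂ kg) (cong proj₁ kh) ,
    b≢d ∘ squeeze-injective (cong proj₂ kg) (cong proj₂ kh)

  AllPairs-Disjoint-squeeze : ∀ {r} → All Kept r → AllPairs Disjoint r → AllPairs Disjoint (map squeezeE r)
  AllPairs-Disjoint-squeeze []        []        = []
  AllPairs-Disjoint-squeeze (kg ∷ kr) (dg ∷ dr) =
    All.map⁺ (All.zipWith (λ (kh , d) → Disjoint-squeeze kg kh d) (kr , dg)) ∷ AllPairs-Disjoint-squeeze kr dr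

  link-ChainIn : ∀ {N} → suc k ≤ N → ∀ c → ChainIn (suc (suc N)) c → ChainIn N (link c)
  link-ChainIn {N} k<N c hc = All.concat⁺ (All.map⁺ (All.map (λ {t} → linkTerm-ChainIn t) hc))
    where
    linkTerm-ChainIn : ∀ t → IsMatching (suc (suc N)) (proj₂ t) → ChainIn N (linkTerm t)
    linkTerm-ChainIn (a , es) m with pick es in found
    ... | nothing      = []
    ... | just (j , r) =
      (All.map⁺ (All.map (uncurry (EdgeIn-squeeze k<N)) (proj₁ (pick-IsMatching m found))) ,
       AllPairs-Disjoint-squeeze (Admissible-IsMatching es m found) (proj₂ (pick-IsMatching m found)))
      ∷ []

  KeptV-large : ∀ {v} → suc (suc k) < v → KeptV v
  KeptV-large k+2<v = keptV (ℕ.≤-trans (s≤s (s≤s z≤n)) (ℕ.<⇒≤ k+2<v)) (ℕ.>⇒≢ k+2<v)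

  shifted-large : ∀ v → suc (suc k) < v + (2 * suc k + 1)
  shifted-large v rewrite shift-suc v k | shift-split v k = s≤s (s≤s (s≤s (ℕ.m≤m+n k (v + k))))

  squeeze-shift : ∀ v → squeeze (v + (2 * suc k + 1)) ≡ v + (2 * k + 1)
  squeeze-shift v =
    trans (squeeze-> (ℕ.<-trans (ℕ.n<1+n (suc k)) (shifted-large v))) (cong (_∸ 2) (shift-suc v k))

  relabel-shift : ∀ γ → relabel (shift (2 * suc k + 1) γ) ≡ shift (2 * k + 1) γ
  relabel-shift γ =
    trans (sym (List.map-∘ γ)) (List.map-cong (λ t → cong (proj₁ t ,_)
      (trans (sym (List.map-∘ (proj₂ t)))
             (List.map-cong (λ f → cong₂ _,_ (squeeze-shift (proj₁ f)) (squeeze-shift (proj₂ f))) (proj₂ t)))) γ)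

  Kept-shift : ∀ γ → All (λ t → All Kept (proj₂ t)) (shift (2 * suc k + 1) γ)
  Kept-shift γ = All.map⁺ (All.universal (λ t → All.map⁺ (All.universal kept (proj₂ t))) γ)
    where
    kept : ∀ f → Kept (proj₁ f + (2 * suc k + 1) , proj₂ f + (2 * suc k + 1))
    kept f = Kept-pair (KeptV-large (shifted-large (proj₁ f))) (KeptV-large (shifted-large (proj₂ f)))

  squeeze-rows : ∀ a n ρ → a + n ≤ suc k →
                 map squeezeE (rows (suc k) (suc a) n (map suc ρ)) ≡ rows k a n ρ
  squeeze-rows a zero    ρ       _   = refl
  squeeze-rows a (suc n) []      _   = refl
  squeeze-rows a (suc n) (p ∷ ρ) a+n≤ = cong₂ _∷_
    (cong₂ _,_ (squeeze-≤ (ℕ.≤-trans (s≤s (ℕ.m≤m+n a n)) a+1+n≤))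
               (trans (cong squeeze (ℕ.+-suc (suc k) p)) (squeeze-> (s≤s (s≤s (ℕ.m≤m+n k p))))))
    (squeeze-rows (suc a) n ρ a+1+n≤)
    where
    a+1+n≤ : suc a + n ≤ suc k
    a+1+n≤ = subst (_≤ suc k) (ℕ.+-suc a n) a+n≤

  Kept-rows : ∀ a n ρ → 1 ≤ a → a + n ≤ suc k → All (1 ≤_) ρ →
              All Kept (rows (suc k) (suc a) n (map suc ρ))
  Kept-rows a zero    ρ       _   _    _          = []
  Kept-rows a (suc n) []      _   _    _          = []
  Kept-rows a (suc n) (p ∷ ρ) 1≤a a+n≤ (1≤p ∷ 1≤ρ) =
    Kept-pair (keptV (s≤s 1≤a) (ℕ.<⇒≢ (s≤s (ℕ.≤-trans (s≤s (ℕ.m≤m+n a n)) a+1+n≤))))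
              (KeptV-large (subst (suc (suc k) <_) (sym (ℕ.+-suc (suc k) p)) (s≤s (s≤s (ℕ.m<m+n k 1≤p)))))
    ∷ Kept-rows (suc a) n ρ (s≤s z≤n) a+1+n≤ 1≤ρ
    where
    a+1+n≤ : suc a + n ≤ suc k
    a+1+n≤ = subst (_≤ suc k) (ℕ.+-suc a n) a+n≤

  Fresh-rows : ∀ m a n π → 2 ≤ a → Fresh (rows m a n π)
  Fresh-rows m a zero    π       _   = []
  Fresh-rows m a (suc n) []      _   = []
  Fresh-rows m a (suc n) (p ∷ π) 2≤a =
    ==E-false {a , m + p} {pivot} (λ eq → ℕ.<⇒≢ 2≤a (sym (cong proj₁ eq)))
    ∷ Fresh-rows m (suc a) n π (ℕ.m≤n⇒m≤1+n 2≤a)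

  Fresh-zTerm : ∀ y π → 2 ≤ y → Fresh (proj₂ (zTerm (suc k) (y ∷ π)))
  Fresh-zTerm y π 2≤y =
    ==E-false {1 , suc k + y} {pivot} (λ eq → ℕ.<⇒≢ 1+k<k+y (sym (ℕ.suc-injective (cong proj₂ eq))))
    ∷ Fresh-rows (suc k) 2 k π ℕ.≤-refl
    where
    1+k<k+y : suc k < k + y
    1+k<k+y = ℕ.≤-trans (ℕ.≤-reflexive (ℕ.+-comm 2 k)) (ℕ.+-monoʳ-≤ k 2≤y)

  pick-zTerm : ∀ ρ → pick (proj₂ (zTerm (suc k) (1 ∷ ρ))) ≡ just (0 , rows (suc k) 2 k ρ)
  pick-zTerm ρ rewrite ==E-true {1 , suc k + 1} {pivot} (cong (1 ,_) (ℕ.+-comm (suc k) 1)) = refl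

  module _ (γ : Chain) where

    private
      Z : List ℕ → Chain
      Z π = zTerm (suc k) π ∧ᵗ shift (2 * suc k + 1) γ

      Fresh-shift : All (λ t → Fresh (proj₂ t)) (shift (2 * suc k + 1) γ)
      Fresh-shift = All.map Kept⇒Fresh (Kept-shift γ)

    link-zTerm-1 : ∀ ρ → link (Z (1 ∷ map suc ρ)) ≡ zTerm k ρ ∧ᵗ shift (2 * k + 1) γ
    link-zTerm-1 ρ = trans
      (link-∧ᵗ-pick (sgn (1 ∷ map suc ρ)) _ (pick-zTerm (map suc ρ)) (shift (2 * suc k + 1) γ))
      (cong₂ _∧ᵗ_ (cong₂ _,_ (trans (ℤ.*-identityʳ _) (sgn-1∷map-suc ρ)) (squeeze-rows 1 k ρ ℕ.≤-refl))
                  (relabel-shift γ))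

    link-zTerm-≥2 : ∀ y π → 2 ≤ y → link (Z (y ∷ π)) ≡ []
    link-zTerm-≥2 y π 2≤y = link-∧ᵗ-Fresh (sgn (y ∷ π)) (Fresh-zTerm y π 2≤y) _ Fresh-shift

    link-liftedPerms : ∀ ρ → All (1 ≤_) ρ →
                       link (concatMap Z (liftedPerms ρ)) ≡ zTerm k ρ ∧ᵗ shift (2 * k + 1) γ
    link-liftedPerms []      _         = trans (cong link (List.++-identityʳ (Z (1 ∷ [])))) (link-zTerm-1 [])
    link-liftedPerms (p ∷ ρ) (1≤p ∷ _) = begin
      link (Z (1 ∷ map suc (p ∷ ρ)) ++ concatMap Z rest)        ≡⟨ link-++ (Z (1 ∷ map suc (p ∷ ρ))) _ ⟩
      link (Z (1 ∷ map suc (p ∷ ρ))) ++ link (concatMap Z rest) ≡⟨ cong₂ _++_ (link-zTerm-1 (p ∷ ρ)) rest-vanishes ⟩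
      zTerm k (p ∷ ρ) ∧ᵗ shift (2 * k + 1) γ ++ []              ≡⟨ List.++-identityʳ _ ⟩
      zTerm k (p ∷ ρ) ∧ᵗ shift (2 * k + 1) γ                    ∎
      where
      open ≡-Reasoning
      rest : List (List ℕ)
      rest = map (suc p ∷_) (liftedPerms ρ)
      rest-vanishes : link (concatMap Z rest) ≡ []
      rest-vanishes = begin
        link (concatMap Z rest)
          ≡⟨ concatMap-concatMap linkTerm Z rest ⟩
        concatMap (link ∘ Z) rest
          ≡⟨ List.concatMap-map (link ∘ Z) (suc p ∷_) (liftedPerms ρ) ⟩
        concatMap (link ∘ Z ∘ (suc p ∷_)) (liftedPerms ρ)
          ≡⟨ concatMap-[] (λ π → link-zTerm-≥2 (suc p) π (s≤s 1≤p)) (liftedPerms ρ) ⟩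
        []
          ∎

    Admissible-zTerm-1 : ∀ ρ → All (1 ≤_) ρ → All (λ t → Admissible (proj₂ t)) (Z (1 ∷ map suc ρ))
    Admissible-zTerm-1 ρ 1≤ρ = Admissible-∧ᵗ-pick (sgn (1 ∷ map suc ρ)) (pick-zTerm (map suc ρ))
                                 (Kept-rows 1 k ρ (s≤s z≤n) ℕ.≤-refl 1≤ρ) _ (Kept-shift γ)

    Admissible-zTerm-≥2 : ∀ y π → 2 ≤ y → All (λ t → Admissible (proj₂ t)) (Z (y ∷ π))
    Admissible-zTerm-≥2 y π 2≤y = Admissible-∧ᵗ-Fresh (sgn (y ∷ π)) (Fresh-zTerm y π 2≤y) _ Fresh-shift

    Admissible-liftedPerms : ∀ ρ → All (1 ≤_) ρ → All (λ t → Admissible (proj₂ t)) (concatMap Z (liftedPerms ρ))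
    Admissible-liftedPerms []      1≤ρ           = All.++⁺ (Admissible-zTerm-1 [] 1≤ρ) []
    Admissible-liftedPerms (p ∷ ρ) 1≤ρ@(1≤p ∷ _) = All.++⁺ (Admissible-zTerm-1 (p ∷ ρ) 1≤ρ)
      (All.concat⁺ (All.map⁺ (All.map⁺
        (All.universal (λ π → Admissible-zTerm-≥2 (suc p) π (s≤s 1≤p)) (liftedPerms ρ)))))

    link-z∧shift : link (zChain (suc k) ∧ᶜ shift (2 * suc k + 1) γ) ≡ zChain k ∧ᶜ shift (2 * k + 1) γ
    link-z∧shift = begin
      link (zChain (suc k) ∧ᶜ shift (2 * suc k + 1) γ)       ≡⟨ cong link (z∧-decomposition k _) ⟩
      link (concatMap (concatMap Z ∘ liftedPerms) P)         ≡⟨ concatMap-concatMap linkTerm _ P ⟩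
      concatMap (link ∘ concatMap Z ∘ liftedPerms) P
        ≡⟨ cong concat (List.map-cong-local (All.map (link-liftedPerms _) (perms-All (range-≥ 1 (suc k))))) ⟩
      concatMap (λ ρ → zTerm k ρ ∧ᵗ shift (2 * k + 1) γ) P   ≡⟨ List.concatMap-map _ (zTerm k) P ⟨
      zChain k ∧ᶜ shift (2 * k + 1) γ                         ∎
      where
      P : List (List ℕ)
      P = perms (range 1 (suc k))
      open ≡-Reasoning

    Admissible-z∧shift : All (λ t → Admissible (proj₂ t)) (zChain (suc k) ∧ᶜ shift (2 * suc k + 1) γ)
    Admissible-z∧shift rewrite z∧-decomposition k (shift (2 * suc k + 1) γ) =
      All.concat⁺ (All.map⁺ (All.map (Admissible-liftedPerms _) (perms-All (range-≥ 1 (suc k)))))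

  link-IsCycle : ∀ {M} w → ChainIn M w → IsCycle w → IsCycle (link w)
  link-IsCycle w hw cycle σ = begin
    coeff (∂ (link w)) σ           ≡⟨ cong (λ c → coeff c σ) ∂-link ⟩
    coeff (negate (link (∂ w))) σ  ≡⟨ coeff-negate (link (∂ w)) σ ⟩
    - coeff (link (∂ w)) σ         ≡⟨ cong -_ (link-≈ᶜ (Admissible-ChainIn (∂ w) (∂-ChainIn w hw)) [] cycle σ) ⟩
    ℤ.+ 0                          ∎
    where
    open ≡-Reasoning
    ∂-link : ∂ (link w) ≡ negate (link (∂ w))
    ∂-link = sym (trans (cong negate (link-∂-ChainIn w hw)) (negate-involutive (∂ (link w))))

  vanishes-descends : ∀ n d p γ →
    VanishesModP (2 * suc k + 1 + n) (suc k + d) p (zChain (suc k) ∧ᶜ shift (2 * suc k + 1) γ) →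
    VanishesModP (2 * k + 1 + n) (k + d) p (zChain k ∧ᶜ shift (2 * k + 1) γ)
  vanishes-descends n d p γ (b , w , hb , |b| , hw , |w| , cycle , z≈∂b+pw) =
    negate (link b) , link w ,
    All.map⁺ (link-ChainIn k<N b hb') , All.map⁺ (link-HasSize _ b |b|) ,
    link-ChainIn k<N w hw' , link-HasSize _ w |w| ,
    link-IsCycle w hw' cycle ,
    relation
    where
    k<N : suc k ≤ 2 * k + 1 + n
    k<N = subst (suc k ≤_) (sym (vertices-split k n)) (ℕ.m≤m+n (suc k) (k + n))
    hb' : ChainIn (suc (suc (2 * k + 1 + n))) b
    hb' = subst (λ M → ChainIn M b) (vertices-suc k n) hb
    hw' : ChainIn (suc (suc (2 * k + 1 + n))) w
    hw' = subst (λ M → ChainIn M w) (vertices-suc k n) hw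
    link-∂b+pw : link (∂ b ⊕ scale (ℤ.+ p) w) ≡ ∂ (negate (link b)) ⊕ scale (ℤ.+ p) (link w)
    link-∂b+pw = begin
      link (∂ b ++ scale (ℤ.+ p) w)                  ≡⟨ link-++ (∂ b) (scale (ℤ.+ p) w) ⟩
      link (∂ b) ++ link (scale (ℤ.+ p) w)           ≡⟨ cong₂ _++_ (link-∂-ChainIn b hb') (link-scale (ℤ.+ p) w) ⟩
      negate (∂ (link b)) ++ scale (ℤ.+ p) (link w)  ≡⟨ cong (_++ scale (ℤ.+ p) (link w)) (∂-negate (link b)) ⟨
      ∂ (negate (link b)) ++ scale (ℤ.+ p) (link w)  ∎
      where open ≡-Reasoning
    admissible : All (λ t → Admissible (proj₂ t)) (∂ b ⊕ scale (ℤ.+ p) w)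
    admissible = All.++⁺ (Admissible-ChainIn (∂ b) (∂-ChainIn b hb'))
                         (Admissible-ChainIn (scale (ℤ.+ p) w) (All.map⁺ hw'))
    relation : (zChain k ∧ᶜ shift (2 * k + 1) γ) ≈ᶜ (∂ (negate (link b)) ⊕ scale (ℤ.+ p) (link w))
    relation σ = begin
      coeff (zChain k ∧ᶜ shift (2 * k + 1) γ) σ                   ≡⟨ cong (λ c → coeff c σ) (link-z∧shift γ) ⟨
      coeff (link (zChain (suc k) ∧ᶜ shift (2 * suc k + 1) γ)) σ  ≡⟨ link-≈ᶜ (Admissible-z∧shift γ) admissible z≈∂b+pw σ ⟩
      coeff (link (∂ b ⊕ scale (ℤ.+ p) w)) σ                      ≡⟨ cong (λ c → coeff c σ) link-∂b+pw ⟩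
      coeff (∂ (negate (link b)) ⊕ scale (ℤ.+ p) (link w)) σ      ∎
      where open ≡-Reasoning

corollary4p2 : (n d p k₀ : ℕ) → Prime p → (γ : Chain) →
    ChainIn n γ → HasSize d γ → IsCycle γ →
    ¬ VanishesModP (2 * k₀ + 1 + n) (k₀ + d) p (zChain k₀ ∧ᶜ shift (2 * k₀ + 1) γ) →
    (k : ℕ) → k₀ ≤ k →
    ¬ VanishesModP (2 * k + 1 + n) (k + d) p (zChain k ∧ᶜ shift (2 * k + 1) γ)
corollary4p2 n d p k₀ _ γ _ _ _ nonzero₀ = nonzero
  where
  nonzero : ∀ k → k₀ ≤ k → ¬ VanishesModP (2 * k + 1 + n) (k + d) p (zChain k ∧ᶜ shift (2 * k + 1) γ)
  nonzero k k₀≤k with ℕ.m≤n⇒m<n∨m≡n k₀≤k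
  ... | inj₂ refl               = nonzero₀
  ... | inj₁ (s≤s {n = j} k₀≤j) = nonzero j k₀≤j ∘ Squeeze.vanishes-descends j n d p γ
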